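{- Let $h,k$ be nonnegative integers. There is a bijection $f:\mathcal{D}_2(h,k,\star)\to\mathcal{D}_2(h-k,k,\star)\cup\mathcal{D}_2(h-k,k-1,\star)$ such that if $f(x)\in\mathcal{D}_2(h-k,k,\star)$ then $x$ and $f(x)$ have the same number of parts, while if $f(x)\in\mathcal{D}_2(h-k,k-1,\star)$ then $f(x)$ has one part fewer than $x$.
   Context: A $2$-distinct partition of $n$ is a partition of $n$ (including the empty partition of $0$) whose parts are split between two (possibly empty) labelled subsets, say "red" and "white", such that the parts within each subset are pairwise distinct. An $(n,j,\star)$-distinct partition is a $2$-distinct partition of $n$ whose red subset has exactly $j$ parts (the white subset may have any number of parts). $\mathcal{D}_2(n,j,\star)$ denotes the set of $(n,j,\star)$-distinct partitions; it is empty if $n<0$ or $j<0$. The number of parts of such a partition is the total number of red and white parts. -}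

module Defs where

open import Data.Nat using (ℕ; _<_; _>_; _+_)
open import Data.Integer using (ℤ; +_)
open import Data.List using (List; length)
open import Data.Nat.ListAction using (sum)
open import Data.List.Relation.Unary.All using (All)
open import Data.List.Relation.Unary.Linked using (Linked)
open import Relation.Binary.PropositionalEquality using (_≡_)

-- A finite set of distinct positive parts, represented canonically as a
-- strictly decreasing list of positive naturals.
record DistinctParts : Set where
  constructor mkDP
  field
    parts    : List ℕ
    positive : All (0 <_) parts
    strict   : Linked _>_ parts
open DistinctParts public

-- D₂(n, j, ⋆): 2-distinct partitions of n whose red subset has exactly j parts.
-- Indexed by integers so that it is empty when n < 0 or j < 0.
record D2 (n j : ℤ) : Set where
  constructor mkD2
  field
    red      : DistinctParts
    white    : DistinctParts
    redCount : + length (parts red) ≡ j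
    total    : + (sum (parts red) + sum (parts white)) ≡ n
open D2 public

numParts : ∀ {n j} → D2 n j → ℕ
numParts x = length (parts (red x)) + length (parts (white x))

-- Subtract 1 from every red part and keep the white parts. The red parts stay
-- positive and distinct, except that a red part equal to 1 disappears; it can
-- only be the smallest red part. The total drops by the number k of red parts,
-- and the red count drops by one exactly when a part 1 was removed. Adding 1 to
-- every red part, and adjoining a red 1 in the second case, inverts this.
module Submission where

open import Defs
open import Data.Nat as ℕ using (ℕ; zero; suc; z<s; s≤s⁻¹)
import Data.Nat.Properties as ℕ
open import Data.Nat.Tactic.RingSolver using (solve-∀)
open import Data.Integer using (ℤ; +_; _-_) renaming (_+_ to _+ℤ_)
import Data.Integer.Properties as ℤ
open import Algebra.Properties.AbelianGroup ℤ.+-0-abelianGroup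
  using (//-rightDividesˡ; //-rightDividesʳ)
open import Data.List using (List; []; _∷_; [_]; _++_; _∷ʳ_; map; length)
open import Data.List.Properties using (length-map; length-++-comm; map-injective; ∷ʳ-injectiveˡ)
open import Data.List.Membership.Propositional using (_∈_; _∉_)
open import Data.List.Membership.Propositional.Properties using (∈-map⁻; ∈-++⁺ʳ)
open import Data.List.Relation.Unary.Any using (here)
open import Data.Nat.ListAction using (sum)
open import Data.Nat.ListAction.Properties using (sum-++)
open import Data.List.Relation.Unary.All as All using (All; []; _∷_)
open import Data.List.Relation.Unary.All.Properties as All using (∷ʳ⁺)
open import Data.List.Relation.Unary.Linked as Linked using (Linked; []; [-]; _∷_)
import Data.List.Relation.Unary.Linked.Properties as Linked
open import Data.Sum using (_⊎_; inj₁; inj₂)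
open import Data.Product using (Σ; _×_; _,_)
open import Data.Empty using (⊥-elim)
open import Function.Bundles using (_⤖_; Bijection; mk↔ₛ′)
open import Function.Properties.Inverse using (↔⇒⤖)
open import Axiom.UniquenessOfIdentityProofs using (module Decidable⇒UIP)
open import Relation.Binary.PropositionalEquality using (_≡_; _≢_; refl; sym; trans; cong; subst; module ≡-Reasoning)

+[m+n]≡i⇒+m≡i-n : ∀ m n {i} → + (m ℕ.+ n) ≡ i → + m ≡ i - + n
+[m+n]≡i⇒+m≡i-n m n refl = sym (trans (cong (_- + n) (ℤ.pos-+ m n)) (//-rightDividesʳ (+ n) (+ m)))

+m≡i-n⇒+[m+n]≡i : ∀ m n {i} → + m ≡ i - + n → + (m ℕ.+ n) ≡ i
+m≡i-n⇒+[m+n]≡i m n {i} e = trans (ℤ.pos-+ m n) (trans (cong (_+ℤ + n) e) (//-rightDividesˡ (+ n) i))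

total-lower : ∀ {a b c L n j} → a ≡ b ℕ.+ L → + L ≡ j → + (a ℕ.+ c) ≡ n → + (b ℕ.+ c) ≡ n - j
total-lower {b = b} {c} {L} refl refl t = +[m+n]≡i⇒+m≡i-n (b ℕ.+ c) L (trans (cong +_ (rearrange b c L)) t)
  where
  rearrange : ∀ b c L → b ℕ.+ c ℕ.+ L ≡ b ℕ.+ L ℕ.+ c
  rearrange = solve-∀

total-raise : ∀ {a b c L n j} → a ≡ b ℕ.+ L → + L ≡ j → + (b ℕ.+ c) ≡ n - j → + (a ℕ.+ c) ≡ n
total-raise {b = b} {c} {L} refl refl t = trans (cong +_ (rearrange b L c)) (+m≡i-n⇒+[m+n]≡i (b ℕ.+ c) L t)
  where
  rearrange : ∀ b L c → b ℕ.+ L ℕ.+ c ≡ b ℕ.+ c ℕ.+ L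
  rearrange = solve-∀

sum-map-suc : ∀ xs → sum (map suc xs) ≡ sum xs ℕ.+ length xs
sum-map-suc []       = refl
sum-map-suc (x ∷ xs) = trans (cong (λ s → suc (x ℕ.+ s)) (sum-map-suc xs)) (rearrange x (sum xs) (length xs))
  where
  rearrange : ∀ a b c → suc (a ℕ.+ (b ℕ.+ c)) ≡ a ℕ.+ b ℕ.+ suc c
  rearrange = solve-∀

length-map-suc-∷ʳ : ∀ xs → length (map suc xs ∷ʳ 1) ≡ suc (length xs)
length-map-suc-∷ʳ xs = trans (length-++-comm (map suc xs) [ 1 ]) (cong suc (length-map suc xs))

sum-map-suc-∷ʳ : ∀ xs → sum (map suc xs ∷ʳ 1) ≡ sum xs ℕ.+ suc (length xs)
sum-map-suc-∷ʳ xs = begin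
  sum (map suc xs ∷ʳ 1)           ≡⟨ sum-++ (map suc xs) [ 1 ] ⟩
  sum (map suc xs) ℕ.+ 1          ≡⟨ cong (ℕ._+ 1) (sum-map-suc xs) ⟩
  sum xs ℕ.+ length xs ℕ.+ 1      ≡⟨ ℕ.+-assoc (sum xs) (length xs) 1 ⟩
  sum xs ℕ.+ (length xs ℕ.+ 1)    ≡⟨ cong (sum xs ℕ.+_) (ℕ.+-comm (length xs) 1) ⟩
  sum xs ℕ.+ suc (length xs)      ∎
  where open ≡-Reasoning

1∉map-suc : ∀ {xs} → All (0 ℕ.<_) xs → 1 ∉ map suc xs
1∉map-suc pos 1∈ with ∈-map⁻ suc 1∈
... | _ , x∈ , refl with () ← All.lookup pos x∈

All-map-suc : ∀ xs → All (0 ℕ.<_) (map suc xs)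
All-map-suc xs = All.map⁺ (All.universal (λ _ → z<s) xs)

Linked-++⁻ˡ : ∀ {a ℓ} {A : Set a} {R : A → A → Set ℓ} xs {ys} → Linked R (xs ++ ys) → Linked R xs
Linked-++⁻ˡ []           _           = []
Linked-++⁻ˡ (x ∷ [])     _           = [-]
Linked-++⁻ˡ (x ∷ y ∷ xs) (Rxy ∷ Rxs) = Rxy ∷ Linked-++⁻ˡ (y ∷ xs) Rxs

Linked-map-suc : ∀ {xs} → Linked ℕ._>_ xs → Linked ℕ._>_ (map suc xs)
Linked-map-suc l = Linked.map⁺ (Linked.map ℕ.s<s l)

Linked-map-suc⁻ : ∀ {xs} → Linked ℕ._>_ (map suc xs) → Linked ℕ._>_ xs
Linked-map-suc⁻ l = Linked.map ℕ.s<s⁻¹ (Linked.map⁻ l)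

Linked-map-suc-∷ʳ : ∀ {xs} → All (0 ℕ.<_) xs → Linked ℕ._>_ xs → Linked ℕ._>_ (map suc xs ∷ʳ 1)
Linked-map-suc-∷ʳ []                  _           = [-]
Linked-map-suc-∷ʳ (0<x ∷ [])          [-]         = ℕ.s<s 0<x ∷ [-]
Linked-map-suc-∷ʳ (_ ∷ pos@(_ ∷ _))   (x>y ∷ l)   = ℕ.s<s x>y ∷ Linked-map-suc-∷ʳ pos l

DistinctParts-≡ : ∀ {p q} → parts p ≡ parts q → p ≡ q
DistinctParts-≡ {mkDP ps pos str} {mkDP .ps pos′ str′} refl
  rewrite All.irrelevant ℕ.<-irrelevant pos pos′
        | Linked.irrelevant ℕ.<-irrelevant str str′ = refl

raise : DistinctParts → DistinctParts
raise (mkDP qs _ str) = mkDP (map suc qs) (All-map-suc qs) (Linked-map-suc str)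

raise₁ : DistinctParts → DistinctParts
raise₁ (mkDP qs pos str) = mkDP (map suc qs ∷ʳ 1) (∷ʳ⁺ (All-map-suc qs) z<s) (Linked-map-suc-∷ʳ pos str)

raise-injective : ∀ {p q} → raise p ≡ raise q → p ≡ q
raise-injective e = DistinctParts-≡ (map-injective ℕ.suc-injective (cong parts e))

raise₁-injective : ∀ {p q} → raise₁ p ≡ raise₁ q → p ≡ q
raise₁-injective {p} {q} e =
  DistinctParts-≡ (map-injective ℕ.suc-injective (∷ʳ-injectiveˡ (map suc (parts p)) (map suc (parts q)) (cong parts e)))

raise≢raise₁ : ∀ {p q} → raise p ≢ raise₁ q
raise≢raise₁ {p} {q} e =
  1∉map-suc (positive p) (subst (1 ∈_) (sym (cong parts e)) (∈-++⁺ʳ (map suc (parts q)) (here refl)))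

data Lowering (ps : List ℕ) : Set where
  raised  : ∀ qs → All (0 ℕ.<_) qs → ps ≡ map suc qs → Lowering ps
  raised₁ : ∀ qs → All (0 ℕ.<_) qs → ps ≡ map suc qs ∷ʳ 1 → Lowering ps

lowering-∷ : ∀ {x ps} → 0 ℕ.< x → Lowering ps → Lowering (suc x ∷ ps)
lowering-∷ {x} 0<x (raised qs pos e)  = raised (x ∷ qs) (0<x ∷ pos) (cong (suc x ∷_) e)
lowering-∷ {x} 0<x (raised₁ qs pos e) = raised₁ (x ∷ qs) (0<x ∷ pos) (cong (suc x ∷_) e)

lowering : ∀ {ps} → All (0 ℕ.<_) ps → Linked ℕ._>_ ps → Lowering ps
lowering {[]}               _         _         = raised [] [] refl
lowering {zero ∷ _}         (() ∷ _)  _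
lowering {suc zero ∷ []}    _         _         = raised₁ [] [] refl
lowering {suc (suc _) ∷ []} _         _         = lowering-∷ z<s (raised [] [] refl)
lowering {suc _ ∷ _ ∷ _}    (_ ∷ pos) (x>y ∷ l) =
  lowering-∷ (ℕ.≤-trans (All.head pos) (s≤s⁻¹ x>y)) (lowering pos l)

data Lowered (p : DistinctParts) : Set where
  raised  : ∀ q → p ≡ raise q → Lowered p
  raised₁ : ∀ q → p ≡ raise₁ q → Lowered p

lowered : ∀ p → Lowered p
lowered (mkDP ps pos str) with lowering pos str
... | raised qs posq refl  = raised (mkDP qs posq (Linked-map-suc⁻ str)) (DistinctParts-≡ refl)
... | raised₁ qs posq refl =
  raised₁ (mkDP qs posq (Linked-map-suc⁻ (Linked-++⁻ˡ (map suc qs) str))) (DistinctParts-≡ refl)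

length-raise : ∀ q {p} → p ≡ raise q → length (parts p) ≡ length (parts q)
length-raise q refl = length-map suc (parts q)

length-raise₁ : ∀ q {p} → p ≡ raise₁ q → length (parts p) ≡ suc (length (parts q))
length-raise₁ q refl = length-map-suc-∷ʳ (parts q)

sum-raise : ∀ q {p} → p ≡ raise q → sum (parts p) ≡ sum (parts q) ℕ.+ length (parts q)
sum-raise q refl = sum-map-suc (parts q)

sum-raise₁ : ∀ q {p} → p ≡ raise₁ q → sum (parts p) ≡ sum (parts q) ℕ.+ suc (length (parts q))
sum-raise₁ q refl = sum-map-suc-∷ʳ (parts q)

D2-≡ : ∀ {n j} {x y : D2 n j} → red x ≡ red y → white x ≡ white y → x ≡ y
D2-≡ {x = mkD2 r w c t} {mkD2 .r .w c′ t′} refl refl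
  rewrite Decidable⇒UIP.≡-irrelevant ℤ._≟_ c c′
        | Decidable⇒UIP.≡-irrelevant ℤ._≟_ t t′ = refl

module LowerRed {n j : ℤ} where

  Lowered-D2 : Set
  Lowered-D2 = D2 (n - j) j ⊎ D2 (n - j) (j - + 1)

  -- e is deliberately not matched against refl: lowerRed∘raiseRed must compute
  -- lowerRedWith on an abstract proof of raise q ≡ raise q′.
  lowerRedWith : (x : D2 n j) → Lowered (red x) → Lowered-D2
  lowerRedWith (mkD2 _ w c t) (raised q e) =
    inj₁ (mkD2 q w count (total-lower (sum-raise q e) count t))
    where
    count : + length (parts q) ≡ j
    count = trans (cong +_ (sym (length-raise q e))) c
  lowerRedWith (mkD2 _ w c t) (raised₁ q e) =
    inj₂ (mkD2 q w (+[m+n]≡i⇒+m≡i-n (length (parts q)) 1 (trans (cong +_ (ℕ.+-comm _ 1)) count))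
               (total-lower (sum-raise₁ q e) count t))
    where
    count : + suc (length (parts q)) ≡ j
    count = trans (cong +_ (sym (length-raise₁ q e))) c

  lowerRed : D2 n j → Lowered-D2
  lowerRed x = lowerRedWith x (lowered (red x))

  raiseRed : Lowered-D2 → D2 n j
  raiseRed (inj₁ (mkD2 q w c t)) = mkD2 (raise q) w count (total-raise (sum-raise q refl) c t)
    where
    count : + length (parts (raise q)) ≡ j
    count = trans (cong +_ (length-raise q refl)) c
  raiseRed (inj₂ (mkD2 q w c t)) = mkD2 (raise₁ q) w count (total-raise (sum-raise₁ q refl) count′ t)
    where
    count′ : + suc (length (parts q)) ≡ j
    count′ = trans (cong +_ (ℕ.+-comm 1 _)) (+m≡i-n⇒+[m+n]≡i (length (parts q)) 1 c)
    count : + length (parts (raise₁ q)) ≡ j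
    count = trans (cong +_ (length-raise₁ q refl)) count′

  raiseRed∘lowerRed : ∀ x → raiseRed (lowerRed x) ≡ x
  raiseRed∘lowerRed x with lowered (red x)
  ... | raised _ refl  = D2-≡ refl refl
  ... | raised₁ _ refl = D2-≡ refl refl

  lowerRed∘raiseRed : ∀ y → lowerRed (raiseRed y) ≡ y
  lowerRed∘raiseRed (inj₁ (mkD2 q w c t)) with lowered (raise q)
  ... | raised _ e  = cong inj₁ (D2-≡ (sym (raise-injective e)) refl)
  ... | raised₁ q′ e = ⊥-elim (raise≢raise₁ {q} {q′} e)
  lowerRed∘raiseRed (inj₂ (mkD2 q w c t)) with lowered (raise₁ q)
  ... | raised q′ e  = ⊥-elim (raise≢raise₁ {q′} {q} (sym e))
  ... | raised₁ _ e = cong inj₂ (D2-≡ (sym (raise₁-injective e)) refl)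

  lowerRed-⤖ : D2 n j ⤖ Lowered-D2
  lowerRed-⤖ = ↔⇒⤖ (mk↔ₛ′ lowerRed raiseRed lowerRed∘raiseRed raiseRed∘lowerRed)

  lowerRed≡⇒≡raiseRed : ∀ {x y} → lowerRed x ≡ y → x ≡ raiseRed y
  lowerRed≡⇒≡raiseRed {x} refl = sym (raiseRed∘lowerRed x)

  numParts-raiseRed-inj₁ : ∀ y → numParts (raiseRed (inj₁ y)) ≡ numParts y
  numParts-raiseRed-inj₁ (mkD2 q w _ _) = cong (ℕ._+ length (parts w)) (length-raise q refl)

  numParts-raiseRed-inj₂ : ∀ y → numParts (raiseRed (inj₂ y)) ≡ suc (numParts y)
  numParts-raiseRed-inj₂ (mkD2 q w _ _) = cong (ℕ._+ length (parts w)) (length-raise₁ q refl)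

  numParts-lowerRed-inj₁ : ∀ x y → lowerRed x ≡ inj₁ y → numParts y ≡ numParts x
  numParts-lowerRed-inj₁ x y e =
    sym (trans (cong numParts (lowerRed≡⇒≡raiseRed e)) (numParts-raiseRed-inj₁ y))

  numParts-lowerRed-inj₂ : ∀ x y → lowerRed x ≡ inj₂ y → suc (numParts y) ≡ numParts x
  numParts-lowerRed-inj₂ x y e =
    sym (trans (cong numParts (lowerRed≡⇒≡raiseRed e)) (numParts-raiseRed-inj₂ y))

lemma2 : (h k : ℕ) →
    Σ (D2 (+ h) (+ k) ⤖ (D2 (+ h - + k) (+ k) ⊎ D2 (+ h - + k) (+ k - + 1))) λ f →
      ((x : D2 (+ h) (+ k)) (y : D2 (+ h - + k) (+ k)) →
        Bijection.to f x ≡ inj₁ y → numParts y ≡ numParts x)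
      × ((x : D2 (+ h) (+ k)) (y : D2 (+ h - + k) (+ k - + 1)) →
        Bijection.to f x ≡ inj₂ y → suc (numParts y) ≡ numParts x)
lemma2 h k = lowerRed-⤖ , numParts-lowerRed-inj₁ , numParts-lowerRed-inj₂
  where open LowerRed {+ h} {+ k}
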